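{- Let $\bar A=\begin{bmatrix}A&0\\ a&1\end{bmatrix}\in\mathbb{R}^{m_1\times n_1}$ and $\bar B=\begin{bmatrix}1&b\\ 0&B\end{bmatrix}\in\mathbb{R}^{m_2\times n_2}$ (with $A\in\mathbb{R}^{(m_1-1)\times(n_1-1)}$, $B\in\mathbb{R}^{(m_2-1)\times(n_2-1)}$, $a,b$ row vectors) be of full row rank, let $c_A\in\mathbb{R}^{m_1-1}$, $c_B\in\mathbb{R}^{m_2-1}$, $c_a,c_b\in\mathbb{R}$, assume $Q=\{z\in\mathbb{R}^{n_1}:\bar Az=(c_A,c_a)^T,z\ge0\}$ and $R=\{z\in\mathbb{R}^{n_2}:\bar Bz=(c_b,c_B)^T,z\ge 0\}$ are simple, and let $$\mathcal{P}=\{(x,s,y)\in\mathbb{R}^{n_1-1}\times\mathbb{R}\times\mathbb{R}^{n_2-1}: Ax=c_A,\ ax+s+by=c_a+c_b,\ By=c_B,\ x,s,y\ge 0\}.$$ If $\mathcal{P}$ is simple, then every vertex $(x,s,y)$ of $\mathcal{P}$ belongs to exactly one of the following three categories (according to the basic variables of its basic feasible solution): (1) $x$ has $m_1$ basic variables, $s$ is nonbasic, $y$ has $m_2-1$ basic variables; (2) $x$ has $m_1-1$ basic variables, $s$ is basic, $y$ has $m_2-1$ basic variables; (3) $x$ has $m_1-1$ basic variables, $s$ is nonbasic, $y$ has $m_2$ basic variables.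
   Context: In a simple polyhedron in standard form, vertices correspond one-to-one to basic feasible solutions, and the basic variables of a vertex are exactly its nonzero coordinates. The triple of counts (number of basic variables in the $x$-block, in $s$, in the $y$-block) is called the basis split of the vertex. -}

module Defs where

open import Data.Nat using (ℕ; zero; suc) renaming (_+_ to _+ℕ_)
open import Data.Fin using (Fin; zero; suc; splitAt)
open import Data.Fin.Subset using (Subset; _∈_; _∉_; ∣_∣)
open import Data.Sum using (_⊎_; [_,_])
open import Data.Product using (Σ; _×_)
open import Relation.Binary.PropositionalEquality using (_≡_)
open import Relation.Binary.Structures using (IsTotalOrder)
open import Relation.Nullary using (¬_)
open import Algebra.Structures using (IsCommutativeRing)

record OrderedField : Set₁ where
  infixl 6 _+_
  infixl 7 _*_
  infix 4 _≤_
  field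
    Carrier : Set
    _+_ _*_ : Carrier → Carrier → Carrier
    -_ : Carrier → Carrier
    0# 1# : Carrier
    isCommutativeRing : IsCommutativeRing _≡_ _+_ _*_ -_ 0# 1#
    0≢1 : ¬ (0# ≡ 1#)
    inverse : ∀ a → ¬ (a ≡ 0#) → Σ Carrier (λ b → a * b ≡ 1#)
    _≤_ : Carrier → Carrier → Set
    ≤-isTotalOrder : IsTotalOrder _≡_ _≤_
    +-mono-≤ : ∀ {a b} c → a ≤ b → a + c ≤ b + c
    *-nonneg : ∀ {a b} → 0# ≤ a → 0# ≤ b → 0# ≤ a * b

module LP (F : OrderedField) where
  open OrderedField F public

  _<_ : Carrier → Carrier → Set
  a < b = (a ≤ b) × ¬ (a ≡ b)

  _-_ : Carrier → Carrier → Carrier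
  a - b = a + (- b)

  Vec : ℕ → Set
  Vec n = Fin n → Carrier

  Mat : ℕ → ℕ → Set
  Mat m n = Fin m → Fin n → Carrier

  sumF : ∀ {n} → (Fin n → Carrier) → Carrier
  sumF {zero} f = 0#
  sumF {suc n} f = f zero + sumF (λ i → f (suc i))

  _·_ : ∀ {m n} → Mat m n → Vec n → Vec m
  (M · z) i = sumF (λ j → M i j * z j)

  FullRowRank : ∀ {m n} → Mat m n → Set
  FullRowRank {m} {n} M =
    (w : Vec m) → (∀ j → sumF (λ i → w i * M i j) ≡ 0#) → ∀ i → w i ≡ 0#

  InPoly : ∀ {m n} → Mat m n → Vec m → Vec n → Set
  InPoly M c z = (∀ i → (M · z) i ≡ c i) × (∀ j → 0# ≤ z j)

  IsVertex : ∀ {m n} → Mat m n → Vec m → Vec n → Set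
  IsVertex {m} {n} M c z =
    InPoly M c z ×
    ((u v : Vec n) (t : Carrier) → InPoly M c u → InPoly M c v →
      0# < t → t < 1# → (∀ j → z j ≡ t * u j + (1# - t) * v j) →
      ∀ j → u j ≡ z j)

  NonzeroCount : ∀ {n} → Vec n → ℕ → Set
  NonzeroCount {n} z k =
    Σ (Subset n) (λ S → (∀ j → (j ∈ S → ¬ (z j ≡ 0#)) × (j ∉ S → z j ≡ 0#)) × ∣ S ∣ ≡ k)

  -- simple standard-form polyhedron with m equality rows: every vertex
  -- (= basic feasible solution) is nondegenerate, i.e. its m basic
  -- variables are exactly its nonzero coordinates.
  Simple : ∀ {m n} → Mat m n → Vec m → Set
  Simple {m} {n} M c = (z : Vec n) → IsVertex M c z → NonzeroCount z m

  -- Ā = [[A, 0], [a, 1]] of size (m1'+1) × (n1'+1)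
  Abar : ∀ {m1' n1'} → Mat m1' n1' → Vec n1' → Mat (m1' +ℕ 1) (n1' +ℕ 1)
  Abar {m1'} {n1'} A a i j =
    [ (λ i' → [ A i' , (λ _ → 0#) ] (splitAt n1' j))
    , (λ _ → [ a , (λ _ → 1#) ] (splitAt n1' j)) ] (splitAt m1' i)

  cQ : ∀ {m1'} → Vec m1' → Carrier → Vec (m1' +ℕ 1)
  cQ {m1'} cA ca i = [ cA , (λ _ → ca) ] (splitAt m1' i)

  -- B̄ = [[1, b], [0, B]] of size (1+m2') × (1+n2')
  Bbar : ∀ {m2' n2'} → Mat m2' n2' → Vec n2' → Mat (1 +ℕ m2') (1 +ℕ n2')
  Bbar {m2'} {n2'} B b i j =
    [ (λ _ → [ (λ _ → 1#) , b ] (splitAt 1 j))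
    , (λ i' → [ (λ _ → 0#) , B i' ] (splitAt 1 j)) ] (splitAt 1 i)

  cR : ∀ {m2'} → Carrier → Vec m2' → Vec (1 +ℕ m2')
  cR cb cB i = [ (λ _ → cb) , cB ] (splitAt 1 i)

  -- constraint matrix of 𝒫 on variables (x, s, y) ∈ F^{n1'} × F × F^{n2'},
  -- rows: A x = c_A ; a x + s + b y = c_a + c_b ; B y = c_B
  Pmat : ∀ {m1' n1' m2' n2'} → Mat m1' n1' → Vec n1' → Mat m2' n2' → Vec n2' →
         Mat (m1' +ℕ (1 +ℕ m2')) (n1' +ℕ (1 +ℕ n2'))
  Pmat {m1'} {n1'} {m2'} {n2'} A a B b i j =
    [ (λ i' → [ A i' , (λ _ → 0#) ] (splitAt n1' j))
    , (λ r → [ (λ _ → [ a , (λ k → [ (λ _ → 1#) , b ] (splitAt 1 k)) ] (splitAt n1' j))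
             , (λ i' → [ (λ _ → 0#) , (λ k → [ (λ _ → 0#) , B i' ] (splitAt 1 k)) ] (splitAt n1' j))
             ] (splitAt 1 r))
    ] (splitAt m1' i)

  Prhs : ∀ {m1' m2'} → Vec m1' → Carrier → Carrier → Vec m2' → Vec (m1' +ℕ (1 +ℕ m2'))
  Prhs {m1'} cA ca cb cB i =
    [ cA , (λ r → [ (λ _ → ca + cb) , cB ] (splitAt 1 r)) ] (splitAt m1' i)

-- At a vertex z of {z : M z = c, z ≥ 0} the columns of M indexed by the support of z are
-- linearly independent: a nonzero w with M w = 0 vanishing off the support would make z ± εw
-- feasible for small ε > 0, exhibiting z as the midpoint of two other feasible points. So if only
-- p rows of M are nonzero on a set T of support columns, then |T| ≤ p. In 𝒫 the columns of x and s
-- meet only the rows of A and the coupling row, and the columns of s and y only the coupling row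
-- and the rows of B; hence |supp x| + [s ≠ 0] ≤ m1' + 1 and [s ≠ 0] + |supp y| ≤ m2' + 1. As 𝒫 is
-- simple the support has exactly m1' + 1 + m2' elements, and the three categories are precisely
-- the ways of meeting both bounds with that total.
module Submission where

open import Defs
open import Data.Nat using (ℕ) renaming (_+_ to _+ℕ_)
open import Data.Fin using (Fin; zero; _↑ˡ_; _↑ʳ_)
open import Data.Sum using (_⊎_)
open import Data.Product using (_×_)
open import Relation.Binary.PropositionalEquality using (_≡_)
open import Relation.Nullary using (¬_)

open import Algebra.Bundles using (CommutativeRing)
open import Algebra.Structures using (IsCommutativeRing)
open import Data.Empty using (⊥; ⊥-elim)
open import Data.Fin using (suc; _≟_)
open import Data.Fin.Properties using (any?; suc-injective; splitAt-↑ˡ; splitAt-↑ʳ)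
open import Data.Fin.Subset
  using (Subset; inside; outside; _∈_; _∉_; _⊆_; ∣_∣; Nonempty)
  renaming (⊥ to ∅; _-_ to _∖_)
open import Data.Fin.Subset.Properties
  using (_∈?_; drop-there; ∉⊥; ∣⊥∣≡0; p─⊥≡p; p─q⊆p; ⊆-refl; ⊆-min; s⊆s)
import Data.Nat as ℕ
import Data.Nat.Properties as ℕₚ
open import Data.Product using (Σ; ∃; _,_; proj₁; proj₂)
open import Data.Sum using (inj₁; inj₂; [_,_]′)
open import Data.Vec using (_∷_; []; _++_)
import Data.Vec as Vec
open import Data.Vec.Properties using (lookup-++ˡ; lookup-++ʳ; []=⇒lookup; lookup⇒[]=)
open import Function using (_∘_)
open import Relation.Binary.PropositionalEquality
  using (refl; sym; trans; cong; cong₂; subst; subst₂; module ≡-Reasoning)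
open import Relation.Binary.Structures using (IsTotalOrder)
open import Relation.Nullary using (Dec; yes; no; ¬¬-excluded-middle)
open import Relation.Nullary.Decidable using (_×-dec_; ¬?)
import Algebra.Properties.Ring as RingProperties
import Algebra.Properties.CommutativeSemigroup as CommutativeSemigroupProperties

data SplitView (m n : ℕ) : Fin (m +ℕ n) → Set where
  left  : (i : Fin m) → SplitView m n (i ↑ˡ n)
  right : (j : Fin n) → SplitView m n (m ↑ʳ j)

splitView : ∀ m {n} (i : Fin (m +ℕ n)) → SplitView m n i
splitView ℕ.zero    i       = right i
splitView (ℕ.suc m) zero    = left zero
splitView (ℕ.suc m) (suc i) with splitView m i
... | left i′  = left (suc i′)
... | right j  = right j

module _ {m n} {p : Subset m} {r : Subset n} where

  ∈-++⁺ˡ : ∀ {i} → i ∈ p → (i ↑ˡ n) ∈ (p ++ r)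
  ∈-++⁺ˡ {i} i∈p = lookup⇒[]= (i ↑ˡ n) (p ++ r) (trans (lookup-++ˡ p r i) ([]=⇒lookup i∈p))

  ∈-++⁺ʳ : ∀ {j} → j ∈ r → (m ↑ʳ j) ∈ (p ++ r)
  ∈-++⁺ʳ {j} j∈r = lookup⇒[]= (m ↑ʳ j) (p ++ r) (trans (lookup-++ʳ p r j) ([]=⇒lookup j∈r))

  ∈-++⁻ˡ : ∀ {i} → (i ↑ˡ n) ∈ (p ++ r) → i ∈ p
  ∈-++⁻ˡ {i} i∈p++r = lookup⇒[]= i p (trans (sym (lookup-++ˡ p r i)) ([]=⇒lookup i∈p++r))

  ∈-++⁻ʳ : ∀ {j} → (m ↑ʳ j) ∈ (p ++ r) → j ∈ r
  ∈-++⁻ʳ {j} j∈p++r = lookup⇒[]= j r (trans (sym (lookup-++ʳ p r j)) ([]=⇒lookup j∈p++r))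

++-mono-⊆ : ∀ {m n} {p p′ : Subset m} {r r′ : Subset n} → p ⊆ p′ → r ⊆ r′ → (p ++ r) ⊆ (p′ ++ r′)
++-mono-⊆ {m} p⊆p′ r⊆r′ {i} i∈p++r with splitView m i
... | left i′ = ∈-++⁺ˡ (p⊆p′ (∈-++⁻ˡ i∈p++r))
... | right j = ∈-++⁺ʳ (r⊆r′ (∈-++⁻ʳ i∈p++r))

∣p++q∣≡∣p∣+∣q∣ : ∀ {m n} (p : Subset m) (q : Subset n) → ∣ p ++ q ∣ ≡ ∣ p ∣ +ℕ ∣ q ∣
∣p++q∣≡∣p∣+∣q∣ []            q = refl
∣p++q∣≡∣p∣+∣q∣ (inside ∷ p)  q = cong ℕ.suc (∣p++q∣≡∣p∣+∣q∣ p q)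
∣p++q∣≡∣p∣+∣q∣ (outside ∷ p) q = ∣p++q∣≡∣p∣+∣q∣ p q

0<∣p∣⇒Nonempty : ∀ {n} (p : Subset n) → 0 ℕ.< ∣ p ∣ → Nonempty p
0<∣p∣⇒Nonempty (inside ∷ p)  _       = zero , Vec.here
0<∣p∣⇒Nonempty (outside ∷ p) 0<∣p∣ with 0<∣p∣⇒Nonempty p 0<∣p∣
... | i , i∈p = suc i , Vec.there i∈p

x∈p⇒∣p-x∣+1≡∣p∣ : ∀ {n} {x : Fin n} (p : Subset n) → x ∈ p → ℕ.suc ∣ p ∖ x ∣ ≡ ∣ p ∣
x∈p⇒∣p-x∣+1≡∣p∣ {x = zero}  (inside ∷ p)  Vec.here          = cong (ℕ.suc ∘ ∣_∣) (p─⊥≡p p)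
x∈p⇒∣p-x∣+1≡∣p∣ {x = suc x} (inside ∷ p)  (Vec.there x∈p) = cong ℕ.suc (x∈p⇒∣p-x∣+1≡∣p∣ p x∈p)
x∈p⇒∣p-x∣+1≡∣p∣ {x = suc x} (outside ∷ p) (Vec.there x∈p) = x∈p⇒∣p-x∣+1≡∣p∣ p x∈p

x∉p-x : ∀ {n} (x : Fin n) (p : Subset n) → x ∉ p ∖ x
x∉p-x zero    (_ ∷ p) ()
x∉p-x (suc x) (_ ∷ p) (Vec.there x∈p-x) = x∉p-x x p x∈p-x

∈-cases : ∀ {n} {A B : Fin n → Set} (T : Subset n) → (∀ {j} → j ∈ T → A j) → (∀ {j} → j ∉ T → B j) →
  ∀ j → A j ⊎ B j
∈-cases T on off j with j ∈? T
... | yes j∈T = inj₁ (on j∈T)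
... | no  j∉T = inj₂ (off j∉T)

¬¬-decidable-Fin : ∀ {n} (P : Fin n → Set) → ¬ ¬ (∀ j → Dec (P j))
¬¬-decidable-Fin {ℕ.zero}  P ¬dec = ¬dec λ ()
¬¬-decidable-Fin {ℕ.suc n} P ¬dec = ¬¬-excluded-middle λ P₀? →
  ¬¬-decidable-Fin (P ∘ suc) λ P? → ¬dec λ { zero → P₀? ; (suc j) → P? j }

module _ (F : OrderedField) where
  open LP F
  open IsCommutativeRing isCommutativeRing
    using (+-assoc; +-comm; +-identityˡ; +-identityʳ; -‿inverseˡ; -‿inverseʳ;
           *-assoc; *-comm; *-identityˡ; *-identityʳ; distribˡ; distribʳ; zeroˡ; zeroʳ)
  open IsTotalOrder ≤-isTotalOrder using (total; antisym) renaming (refl to ≤-refl; trans to ≤-trans)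

  private
    commutativeRing : CommutativeRing _ _
    commutativeRing = record { isCommutativeRing = isCommutativeRing }

  open RingProperties (CommutativeRing.ring commutativeRing)
    using (-‿distribˡ-*; -‿distribʳ-*; -‿involutive; +-identityʳ-unique; -1*x≈-x)
  open CommutativeSemigroupProperties (CommutativeRing.+-commutativeSemigroup commutativeRing)
    using () renaming (interchange to +-interchange)
  open CommutativeSemigroupProperties (CommutativeRing.*-commutativeSemigroup commutativeRing)
    using (x∙yz≈y∙xz; xy∙z≈zy∙x)
  open ≡-Reasoning

  x≤y⇒0≤y-x : ∀ {x y} → x ≤ y → 0# ≤ y - x
  x≤y⇒0≤y-x {x} x≤y = subst (_≤ _) (-‿inverseʳ x) (+-mono-≤ (- x) x≤y)

  0≤y-x⇒x≤y : ∀ {x y} → 0# ≤ y - x → x ≤ y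
  0≤y-x⇒x≤y {x} {y} 0≤y-x = subst₂ _≤_ (+-identityˡ x) y-x+x≡y (+-mono-≤ x 0≤y-x)
    where
    y-x+x≡y : y - x + x ≡ y
    y-x+x≡y = trans (+-assoc y (- x) x) (trans (cong (y +_) (-‿inverseˡ x)) (+-identityʳ y))

  0≤x⇒-x≤0 : ∀ {x} → 0# ≤ x → - x ≤ 0#
  0≤x⇒-x≤0 {x} 0≤x = subst₂ _≤_ (+-identityˡ (- x)) (-‿inverseʳ x) (+-mono-≤ (- x) 0≤x)

  x≤0⇒0≤-x : ∀ {x} → x ≤ 0# → 0# ≤ - x
  x≤0⇒0≤-x {x} x≤0 = subst₂ _≤_ (-‿inverseʳ x) (+-identityˡ (- x)) (+-mono-≤ (- x) x≤0)

  *-monoʳ-≤-nonneg : ∀ {e x y} → 0# ≤ e → x ≤ y → e * x ≤ e * y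
  *-monoʳ-≤-nonneg {e} {x} {y} 0≤e x≤y = 0≤y-x⇒x≤y (subst (0# ≤_) e[y-x]≡ey-ex (*-nonneg 0≤e (x≤y⇒0≤y-x x≤y)))
    where
    e[y-x]≡ey-ex : e * (y - x) ≡ (e * y) - (e * x)
    e[y-x]≡ey-ex = trans (distribˡ e y (- x)) (cong (e * y +_) (sym (-‿distribʳ-* e x)))

  *-monoˡ-≤-nonneg : ∀ {e x y} → 0# ≤ e → x ≤ y → x * e ≤ y * e
  *-monoˡ-≤-nonneg {e} {x} {y} 0≤e x≤y = subst₂ _≤_ (*-comm e x) (*-comm e y) (*-monoʳ-≤-nonneg 0≤e x≤y)

  0≤1 : 0# ≤ 1#
  0≤1 with total 0# 1#
  ... | inj₁ 0≤1 = 0≤1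
  ... | inj₂ 1≤0 = subst (0# ≤_) -1*-1≡1 (*-nonneg (x≤0⇒0≤-x 1≤0) (x≤0⇒0≤-x 1≤0))
    where
    -1*-1≡1 : - 1# * - 1# ≡ 1#
    -1*-1≡1 = trans (sym (-‿distribˡ-* 1# (- 1#))) (trans (cong -_ (*-identityˡ (- 1#))) (-‿involutive 1#))

  ¬1≤0 : ¬ 1# ≤ 0#
  ¬1≤0 1≤0 = 0≢1 (antisym 0≤1 1≤0)

  0≤x∧x*y≡1⇒0≤y : ∀ {x y} → 0# ≤ x → x * y ≡ 1# → 0# ≤ y
  0≤x∧x*y≡1⇒0≤y {x} {y} 0≤x x*y≡1 with total 0# y
  ... | inj₁ 0≤y = 0≤y
  ... | inj₂ y≤0 = ⊥-elim (¬1≤0 (subst (_≤ 0#) (-‿involutive 1#) (0≤x⇒-x≤0 0≤-1)))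
    where
    0≤-1 : 0# ≤ - 1#
    0≤-1 = subst (0# ≤_) (trans (sym (-‿distribʳ-* x y)) (cong -_ x*y≡1)) (*-nonneg 0≤x (x≤0⇒0≤-x y≤0))

  x≢0∧x*y≡0⇒y≡0 : ∀ {x y} → ¬ x ≡ 0# → x * y ≡ 0# → y ≡ 0#
  x≢0∧x*y≡0⇒y≡0 {x} {y} x≢0 x*y≡0 with inverse x x≢0
  ... | x⁻¹ , x*x⁻¹≡1 = begin
    y              ≡⟨ *-identityˡ y ⟨
    1# * y         ≡⟨ cong (_* y) (trans (sym x*x⁻¹≡1) (*-comm x x⁻¹)) ⟩
    x⁻¹ * x * y    ≡⟨ *-assoc x⁻¹ x y ⟩
    x⁻¹ * (x * y)  ≡⟨ cong (x⁻¹ *_) x*y≡0 ⟩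
    x⁻¹ * 0#       ≡⟨ zeroʳ x⁻¹ ⟩
    0#             ∎

  absBound : ∀ w → Σ Carrier λ A → 0# ≤ A × w ≤ A × - w ≤ A
  absBound w with total 0# w
  ... | inj₁ 0≤w = w , 0≤w , ≤-refl , ≤-trans (0≤x⇒-x≤0 0≤w) 0≤w
  ... | inj₂ w≤0 = - w , x≤0⇒0≤-x w≤0 , ≤-trans w≤0 (x≤0⇒0≤-x w≤0) , ≤-refl

  positive-lowerBound : ∀ {n} (f : Vec n) → (∀ j → 0# < f j) → Σ Carrier λ e → 0# < e × (∀ j → e ≤ f j)
  positive-lowerBound {ℕ.zero}  f f>0 = 1# , (0≤1 , 0≢1) , λ ()
  positive-lowerBound {ℕ.suc n} f f>0 with positive-lowerBound (f ∘ suc) (f>0 ∘ suc)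
  ... | e , e>0 , e≤f with total (f zero) e
  ...   | inj₁ f₀≤e = f zero , f>0 zero , λ { zero → ≤-refl ; (suc j) → ≤-trans f₀≤e (e≤f j) }
  ...   | inj₂ e≤f₀ = e , e>0 , λ { zero → e≤f₀ ; (suc j) → e≤f j }

  0≤x⇒1≤x+1 : ∀ {x} → 0# ≤ x → 1# ≤ x + 1#
  0≤x⇒1≤x+1 {x} 0≤x = subst (_≤ x + 1#) (+-identityˡ 1#) (+-mono-≤ 1# 0≤x)

  x≤x+1 : ∀ x → x ≤ x + 1#
  x≤x+1 x = subst₂ _≤_ (+-identityˡ x) (+-comm 1# x) (+-mono-≤ x 0≤1)

  1+1≢0 : ¬ 1# + 1# ≡ 0#
  1+1≢0 1+1≡0 = ¬1≤0 (subst (1# ≤_) 1+1≡0 (0≤x⇒1≤x+1 0≤1))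

  ½ : Carrier
  ½ = proj₁ (inverse (1# + 1#) 1+1≢0)

  ½+½≡1 : ½ + ½ ≡ 1#
  ½+½≡1 = trans (cong₂ _+_ (sym (*-identityˡ ½)) (sym (*-identityˡ ½)))
                (trans (sym (distribʳ ½ 1# 1#)) (proj₂ (inverse (1# + 1#) 1+1≢0)))

  0<½ : 0# < ½
  0<½ = 0≤½ , λ 0≡½ → 0≢1 (trans (sym (+-identityˡ 0#)) (trans (cong₂ _+_ 0≡½ 0≡½) ½+½≡1))
    where
    0≤½ : 0# ≤ ½
    0≤½ = 0≤x∧x*y≡1⇒0≤y (≤-trans 0≤1 (0≤x⇒1≤x+1 0≤1)) (proj₂ (inverse (1# + 1#) 1+1≢0))

  ½<1 : ½ < 1#
  ½<1 = subst₂ _≤_ (+-identityˡ ½) ½+½≡1 (+-mono-≤ ½ (proj₁ 0<½))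
      , λ ½≡1 → 0≢1 (sym (+-identityʳ-unique 1# 1# (trans (cong₂ _+_ (sym ½≡1) (sym ½≡1)) ½+½≡1)))

  1-½≡½ : 1# - ½ ≡ ½
  1-½≡½ = begin
    1# - ½          ≡⟨ cong (_- ½) ½+½≡1 ⟨
    (½ + ½) - ½     ≡⟨ +-assoc ½ ½ (- ½) ⟩
    ½ + (½ - ½)     ≡⟨ cong (½ +_) (-‿inverseʳ ½) ⟩
    ½ + 0#          ≡⟨ +-identityʳ ½ ⟩
    ½               ∎

  sumF-cong : ∀ {n} {f g : Vec n} → (∀ j → f j ≡ g j) → sumF f ≡ sumF g
  sumF-cong {ℕ.zero}  f≡g = refl
  sumF-cong {ℕ.suc n} f≡g = cong₂ _+_ (f≡g zero) (sumF-cong (f≡g ∘ suc))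

  sumF-zero : ∀ {n} {f : Vec n} → (∀ j → f j ≡ 0#) → sumF f ≡ 0#
  sumF-zero {ℕ.zero}  f≡0 = refl
  sumF-zero {ℕ.suc n} f≡0 = trans (cong₂ _+_ (f≡0 zero) (sumF-zero (f≡0 ∘ suc))) (+-identityˡ 0#)

  sumF-+ : ∀ {n} (f g : Vec n) → sumF (λ j → f j + g j) ≡ sumF f + sumF g
  sumF-+ {ℕ.zero}  f g = sym (+-identityˡ 0#)
  sumF-+ {ℕ.suc n} f g = trans (cong (f zero + g zero +_) (sumF-+ (f ∘ suc) (g ∘ suc)))
    (+-interchange (f zero) (g zero) (sumF (f ∘ suc)) (sumF (g ∘ suc)))

  sumF-* : ∀ {n} c (f : Vec n) → sumF (λ j → c * f j) ≡ c * sumF f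
  sumF-* {ℕ.zero}  c f = sym (zeroʳ c)
  sumF-* {ℕ.suc n} c f = trans (cong (c * f zero +_) (sumF-* c (f ∘ suc))) (sym (distribˡ c _ _))

  sumF-single : ∀ {n} (f : Vec n) j₀ → (∀ j → ¬ j ≡ j₀ → f j ≡ 0#) → sumF f ≡ f j₀
  sumF-single f zero f≡0 = trans (cong (f zero +_) (sumF-zero λ j → f≡0 (suc j) λ ())) (+-identityʳ (f zero))
  sumF-single f (suc j₀) f≡0 =
    trans (cong₂ _+_ (f≡0 zero λ ()) (sumF-single (f ∘ suc) j₀ λ j j≢j₀ → f≡0 (suc j) (j≢j₀ ∘ suc-injective)))
          (+-identityˡ (f (suc j₀)))

  infix 7 _⊙_
  _⊙_ : ∀ {n} → Vec n → Vec n → Carrier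
  u ⊙ v = sumF (λ j → u j * v j)

  ⊙-comm : ∀ {n} (u v : Vec n) → u ⊙ v ≡ v ⊙ u
  ⊙-comm u v = sumF-cong λ j → *-comm (u j) (v j)

  ⊙-affineʳ : ∀ {n} (ρ u : Vec n) k (v : Vec n) → ρ ⊙ (λ j → u j + k * v j) ≡ ρ ⊙ u + k * (ρ ⊙ v)
  ⊙-affineʳ ρ u k v = begin
    ρ ⊙ (λ j → u j + k * v j)                     ≡⟨ sumF-cong termwise ⟩
    sumF (λ j → ρ j * u j + k * (ρ j * v j))      ≡⟨ sumF-+ (λ j → ρ j * u j) (λ j → k * (ρ j * v j)) ⟩
    ρ ⊙ u + sumF (λ j → k * (ρ j * v j))          ≡⟨ cong (ρ ⊙ u +_) (sumF-* k (λ j → ρ j * v j)) ⟩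
    ρ ⊙ u + k * (ρ ⊙ v)                           ∎
    where
    termwise : ∀ j → ρ j * (u j + k * v j) ≡ ρ j * u j + k * (ρ j * v j)
    termwise j = trans (distribˡ (ρ j) (u j) (k * v j)) (cong (ρ j * u j +_) (x∙yz≈y∙xz (ρ j) k (v j)))

  ⊙-affineˡ : ∀ {n} (ρ : Vec n) k (σ w : Vec n) → (λ j → ρ j + k * σ j) ⊙ w ≡ ρ ⊙ w + k * (σ ⊙ w)
  ⊙-affineˡ ρ k σ w = begin
    (λ j → ρ j + k * σ j) ⊙ w      ≡⟨ ⊙-comm _ w ⟩
    w ⊙ (λ j → ρ j + k * σ j)      ≡⟨ ⊙-affineʳ w ρ k σ ⟩
    w ⊙ ρ + k * (w ⊙ σ)            ≡⟨ cong₂ (λ a b → a + k * b) (⊙-comm w ρ) (⊙-comm w σ) ⟩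
    ρ ⊙ w + k * (σ ⊙ w)            ∎

  ⊙-vanishes : ∀ {n} (u v : Vec n) → (∀ j → u j ≡ 0# ⊎ v j ≡ 0#) → u ⊙ v ≡ 0#
  ⊙-vanishes u v u⊎v≡0 = sumF-zero λ j → [ (λ u≡0 → trans (cong (_* v j) u≡0) (zeroˡ (v j)))
                                         , (λ v≡0 → trans (cong (u j *_) v≡0) (zeroʳ (u j))) ]′ (u⊎v≡0 j)

  unit : ∀ {n} → Fin n → Vec n
  unit j₀ j with j ≟ j₀
  ... | yes _ = 1#
  ... | no  _ = 0#

  unit-diag : ∀ {n} (j₀ : Fin n) → unit j₀ j₀ ≡ 1#
  unit-diag j₀ with j₀ ≟ j₀
  ... | yes _    = refl
  ... | no  j₀≢j₀ = ⊥-elim (j₀≢j₀ refl)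

  unit-offDiag : ∀ {n} {j j₀ : Fin n} → ¬ j ≡ j₀ → unit j₀ j ≡ 0#
  unit-offDiag {j = j} {j₀} j≢j₀ with j ≟ j₀
  ... | yes j≡j₀ = ⊥-elim (j≢j₀ j≡j₀)
  ... | no  _    = refl

  ⊙-unit : ∀ {n} (ρ : Vec n) j₀ → ρ ⊙ unit j₀ ≡ ρ j₀
  ⊙-unit ρ j₀ = trans (sumF-single _ j₀ λ j j≢j₀ → trans (cong (ρ j *_) (unit-offDiag j≢j₀)) (zeroʳ (ρ j)))
                      (trans (cong (ρ j₀ *_) (unit-diag j₀)) (*-identityʳ (ρ j₀)))

  record KernelVector {p q} (M : Mat p q) (T : Subset q) : Set where
    field
      vec         : Vec q
      supported   : ∀ j → j ∉ T → vec j ≡ 0#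
      witness     : Fin q
      nonzero     : ¬ vec witness ≡ 0#
      annihilated : ∀ i → M i ⊙ vec ≡ 0#

  unitKernelVector : ∀ {q} (M : Mat 0 q) {T j₀} → j₀ ∈ T → KernelVector M T
  unitKernelVector M {T} {j₀} j₀∈T = record
    { vec         = unit j₀
    ; supported   = λ j j∉T → unit-offDiag λ j≡j₀ → j∉T (subst (_∈ T) (sym j≡j₀) j₀∈T)
    ; witness     = j₀
    ; nonzero     = λ e₀ → 0≢1 (trans (sym e₀) (unit-diag j₀))
    ; annihilated = λ ()
    }

  dropVanishingRow : ∀ {p q} (M : Mat (ℕ.suc p) q) {T} →
    (∀ {j} → j ∈ T → M zero j ≡ 0#) → KernelVector (M ∘ suc) T → KernelVector M T
  dropVanishingRow M {T} M₀≡0 kv = record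
    { vec         = vec
    ; supported   = supported
    ; witness     = witness
    ; nonzero     = nonzero
    ; annihilated = λ { zero → ⊙-vanishes (M zero) vec (∈-cases T M₀≡0 (supported _))
                      ; (suc i) → annihilated i }
    }
    where open KernelVector kv

  -[xz]y≡-[yz]x : ∀ x y z → (- (x * z)) * y ≡ (- (y * z)) * x
  -[xz]y≡-[yz]x x y z = begin
    (- (x * z)) * y   ≡⟨ -‿distribˡ-* (x * z) y ⟨
    - (x * z * y)     ≡⟨ cong -_ (xy∙z≈zy∙x x z y) ⟩
    - (y * z * x)     ≡⟨ -‿distribˡ-* (y * z) x ⟩
    (- (y * z)) * x   ∎

  -- Rows 1…p with their pivot-column entry cleared by row 0; r⁻¹ is the inverse of the pivot M₀ⱼ₀.
  eliminate : ∀ {p q} → Mat (ℕ.suc p) q → Fin q → Carrier → Mat p q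
  eliminate M j₀ r⁻¹ i j = M (suc i) j + (- (M (suc i) j₀ * r⁻¹)) * M zero j

  -- Back substitution: the pivot variable is chosen to satisfy row 0.
  liftKernelVector : ∀ {p q} (M : Mat (ℕ.suc p) q) {T j₀ r⁻¹} → j₀ ∈ T → M zero j₀ * r⁻¹ ≡ 1# →
    KernelVector (eliminate M j₀ r⁻¹) (T ∖ j₀) → KernelVector M T
  liftKernelVector M {T} {j₀} {r⁻¹} j₀∈T pivot*r⁻¹≡1 kv = record
    { vec         = w
    ; supported   = λ j j∉T → trans (w≡w′ (≢j₀ j∉T)) (supported j (j∉T ∘ p─q⊆p T _))
    ; witness     = witness
    ; nonzero     = nonzero ∘ trans (sym (w≡w′ witness≢j₀))
    ; annihilated = annihilates
    }
    where
    open KernelVector kv renaming (vec to w′)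
    R = M zero ⊙ w′
    λ₀ = - (R * r⁻¹)
    w : Vec _
    w j = w′ j + λ₀ * unit j₀ j
    ≢j₀ : ∀ {j} → j ∉ T → ¬ j ≡ j₀
    ≢j₀ j∉T j≡j₀ = j∉T (subst (_∈ T) (sym j≡j₀) j₀∈T)
    w≡w′ : ∀ {j} → ¬ j ≡ j₀ → w j ≡ w′ j
    w≡w′ {j} j≢j₀ = trans (cong (λ e → w′ j + λ₀ * e) (unit-offDiag j≢j₀))
                          (trans (cong (w′ j +_) (zeroʳ λ₀)) (+-identityʳ (w′ j)))
    witness≢j₀ : ¬ witness ≡ j₀
    witness≢j₀ witness≡j₀ = nonzero (supported witness (subst (_∉ T ∖ j₀) (sym witness≡j₀) (x∉p-x j₀ T)))
    ρ⊙w : ∀ ρ → ρ ⊙ w ≡ ρ ⊙ w′ + λ₀ * ρ j₀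
    ρ⊙w ρ = trans (⊙-affineʳ ρ w′ λ₀ (unit j₀)) (cong (λ e → ρ ⊙ w′ + λ₀ * e) (⊙-unit ρ j₀))
    annihilates : ∀ i → M i ⊙ w ≡ 0#
    annihilates zero = begin
      M zero ⊙ w                          ≡⟨ ρ⊙w (M zero) ⟩
      R + λ₀ * M zero j₀                  ≡⟨ cong (R +_) (-[xz]y≡-[yz]x R (M zero j₀) r⁻¹) ⟩
      R + (- (M zero j₀ * r⁻¹)) * R       ≡⟨ cong (λ e → R + (- e) * R) pivot*r⁻¹≡1 ⟩
      R + (- 1#) * R                      ≡⟨ cong (R +_) (-1*x≈-x R) ⟩
      R - R                               ≡⟨ -‿inverseʳ R ⟩
      0#                                  ∎
    annihilates (suc i) = begin
      M (suc i) ⊙ w                                  ≡⟨ ρ⊙w (M (suc i)) ⟩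
      M (suc i) ⊙ w′ + λ₀ * M (suc i) j₀             ≡⟨ cong (M (suc i) ⊙ w′ +_) (-[xz]y≡-[yz]x R (M (suc i) j₀) r⁻¹) ⟩
      M (suc i) ⊙ w′ + (- (M (suc i) j₀ * r⁻¹)) * R  ≡⟨ ⊙-affineˡ (M (suc i)) _ (M zero) w′ ⟨
      eliminate M j₀ r⁻¹ i ⊙ w′                      ≡⟨ annihilated i ⟩
      0#                                             ∎

  -- Equality in F need not be decidable, so the pivot search of Gaussian elimination only succeeds
  -- under a double negation; that is enough, since the kernel vector is only used for a contradiction.
  ¬¬-kernelVector : ∀ {p q} (M : Mat p q) (T : Subset q) → p ℕ.< ∣ T ∣ → ¬ ¬ KernelVector M T
  ¬¬-kernelVector {ℕ.zero}  M T 0<∣T∣ ¬kv = ¬kv (unitKernelVector M (proj₂ (0<∣p∣⇒Nonempty T 0<∣T∣)))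
  ¬¬-kernelVector {ℕ.suc p} M T p<∣T∣ ¬kv = ¬¬-decidable-Fin (λ j → M zero j ≡ 0#) reduce
    where
    reduce : (∀ j → Dec (M zero j ≡ 0#)) → ⊥
    reduce M₀≡0? with any? (λ j → (j ∈? T) ×-dec ¬? (M₀≡0? j))
    ... | yes (j₀ , j₀∈T , pivot≢0) with inverse (M zero j₀) pivot≢0
    ...   | r⁻¹ , pivot*r⁻¹≡1 =
      ¬¬-kernelVector (eliminate M j₀ r⁻¹) (T ∖ j₀) p<∣T∖j₀∣ (¬kv ∘ liftKernelVector M j₀∈T pivot*r⁻¹≡1)
      where
      p<∣T∖j₀∣ : p ℕ.< ∣ T ∖ j₀ ∣
      p<∣T∖j₀∣ = ℕₚ.≤-pred (subst (ℕ.suc (ℕ.suc p) ℕ.≤_) (sym (x∈p⇒∣p-x∣+1≡∣p∣ T j₀∈T)) p<∣T∣)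
    reduce M₀≡0? | no ∄pivot =
      ¬¬-kernelVector (M ∘ suc) T (ℕₚ.<-trans (ℕₚ.n<1+n p) p<∣T∣) (¬kv ∘ dropVanishingRow M M₀≡0)
      where
      M₀≡0 : ∀ {j} → j ∈ T → M zero j ≡ 0#
      M₀≡0 {j} j∈T with M₀≡0? j
      ... | yes M₀ⱼ≡0 = M₀ⱼ≡0
      ... | no  M₀ⱼ≢0 = ⊥-elim (∄pivot (j , j∈T , M₀ⱼ≢0))

  translate-inPoly : ∀ {m n} {M : Mat m n} {c z w} k → InPoly M c z → (∀ i → M i ⊙ w ≡ 0#) →
    (∀ j → 0# ≤ z j + k * w j) → InPoly M c (λ j → z j + k * w j)
  translate-inPoly {M = M} {c} {z} {w} k (Mz≡c , _) Mw≡0 0≤z+kw = Mz′≡c , 0≤z+kw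
    where
    Mz′≡c : ∀ i → M i ⊙ (λ j → z j + k * w j) ≡ c i
    Mz′≡c i = begin
      M i ⊙ (λ j → z j + k * w j)  ≡⟨ ⊙-affineʳ (M i) z k w ⟩
      M i ⊙ z + k * (M i ⊙ w)      ≡⟨ cong₂ (λ a b → a + k * b) (Mz≡c i) (Mw≡0 i) ⟩
      c i + k * 0#                 ≡⟨ cong (c i +_) (zeroʳ k) ⟩
      c i + 0#                     ≡⟨ +-identityʳ (c i) ⟩
      c i                          ∎

  midpoint : ∀ x d → ½ * (x + d) + (1# - ½) * (x + - d) ≡ x
  midpoint x d = begin
    ½ * (x + d) + (1# - ½) * (x + - d)  ≡⟨ cong (λ t → ½ * (x + d) + t * (x + - d)) 1-½≡½ ⟩
    ½ * (x + d) + ½ * (x + - d)         ≡⟨ distribˡ ½ (x + d) (x + - d) ⟨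
    ½ * ((x + d) + (x + - d))           ≡⟨ cong (½ *_) (+-interchange x d x (- d)) ⟩
    ½ * ((x + x) + (d + - d))           ≡⟨ cong (λ e → ½ * ((x + x) + e)) (-‿inverseʳ d) ⟩
    ½ * ((x + x) + 0#)                  ≡⟨ cong (½ *_) (+-identityʳ (x + x)) ⟩
    ½ * (x + x)                         ≡⟨ *-comm ½ (x + x) ⟩
    (x + x) * ½                         ≡⟨ distribʳ ½ x x ⟩
    x * ½ + x * ½                       ≡⟨ distribˡ x ½ ½ ⟨
    x * (½ + ½)                         ≡⟨ cong (x *_) ½+½≡1 ⟩
    x * 1#                              ≡⟨ *-identityʳ x ⟩
    x                                   ∎

  vertex-rigid : ∀ {m n} {M : Mat m n} {c z w ε} → IsVertex M c z → (∀ i → M i ⊙ w ≡ 0#) → 0# < ε →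
    (∀ j → 0# ≤ z j + ε * w j) → (∀ j → 0# ≤ z j + (- ε) * w j) → ∀ j → w j ≡ 0#
  vertex-rigid {z = z} {w} {ε} (z∈P , extreme) Mw≡0 (_ , 0≢ε) 0≤z+εw 0≤z-εw j =
    x≢0∧x*y≡0⇒y≡0 (0≢ε ∘ sym) (+-identityʳ-unique (z j) (ε * w j) (extreme _ _ ½ u∈P v∈P 0<½ ½<1 z≡mid j))
    where
    u∈P = translate-inPoly ε z∈P Mw≡0 0≤z+εw
    v∈P = translate-inPoly (- ε) z∈P Mw≡0 0≤z-εw
    z≡mid : ∀ j → z j ≡ ½ * (z j + ε * w j) + (1# - ½) * (z j + (- ε) * w j)
    z≡mid j = trans (sym (midpoint (z j) (ε * w j)))
                    (cong (λ d → ½ * (z j + ε * w j) + (1# - ½) * (z j + d)) (-‿distribˡ-* ε (w j)))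

  -- |w| + 1 rather than |w|, so that the bound is invertible without deciding w ≟ 0.
  invertibleAbsBound : ∀ w → Σ Carrier λ B → Σ Carrier λ B⁻¹ → 0# ≤ B × B * B⁻¹ ≡ 1# × w ≤ B × - w ≤ B
  invertibleAbsBound w with absBound w
  ... | A , 0≤A , w≤A , -w≤A with inverse (A + 1#) (λ A+1≡0 → ¬1≤0 (subst (1# ≤_) A+1≡0 (0≤x⇒1≤x+1 0≤A)))
  ...   | B⁻¹ , B*B⁻¹≡1 =
    A + 1# , B⁻¹ , ≤-trans 0≤1 (0≤x⇒1≤x+1 0≤A) , B*B⁻¹≡1 , ≤-trans w≤A (x≤x+1 A) , ≤-trans -w≤A (x≤x+1 A)

  coordinateStep : ∀ {z w} → 0# ≤ z → (¬ z ≡ 0#) ⊎ w ≡ 0# →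
    Σ Carrier λ δ → 0# < δ × (∀ e → 0# ≤ e → e ≤ δ → 0# ≤ z + e * w × 0# ≤ z + (- e) * w)
  coordinateStep {z} {w} 0≤z (inj₂ w≡0) = 1# , (0≤1 , 0≢1) , λ e _ _ → 0≤z+kw e , 0≤z+kw (- e)
    where
    0≤z+kw : ∀ k → 0# ≤ z + k * w
    0≤z+kw k = subst (0# ≤_) z≡z+kw 0≤z
      where
      z≡z+kw : z ≡ z + k * w
      z≡z+kw = sym (trans (cong (λ x → z + k * x) w≡0) (trans (cong (z +_) (zeroʳ k)) (+-identityʳ z)))
  coordinateStep {z} {w} 0≤z (inj₁ z≢0) with invertibleAbsBound w
  ... | B , B⁻¹ , 0≤B , B*B⁻¹≡1 , w≤B , -w≤B = z * B⁻¹ , (0≤δ , δ≢0) , steps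
    where
    0≤δ : 0# ≤ z * B⁻¹
    0≤δ = *-nonneg 0≤z (0≤x∧x*y≡1⇒0≤y 0≤B B*B⁻¹≡1)
    δ≢0 : ¬ 0# ≡ z * B⁻¹
    δ≢0 0≡δ = z≢0 (x≢0∧x*y≡0⇒y≡0 B⁻¹≢0 (trans (*-comm B⁻¹ z) (sym 0≡δ)))
      where
      B⁻¹≢0 : ¬ B⁻¹ ≡ 0#
      B⁻¹≢0 B⁻¹≡0 = 0≢1 (trans (sym (zeroʳ B)) (trans (cong (B *_) (sym B⁻¹≡0)) B*B⁻¹≡1))
    δB≡z : z * B⁻¹ * B ≡ z
    δB≡z = trans (*-assoc z B⁻¹ B) (trans (cong (z *_) (trans (*-comm B⁻¹ B) B*B⁻¹≡1)) (*-identityʳ z))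
    steps : ∀ e → 0# ≤ e → e ≤ z * B⁻¹ → 0# ≤ z + e * w × 0# ≤ z + (- e) * w
    steps e 0≤e e≤δ = subst (0# ≤_) z-e[-w]≡z+ew (x≤y⇒0≤y-x (ex≤z -w≤B))
                    , subst (0# ≤_) (cong (z +_) (-‿distribˡ-* e w)) (x≤y⇒0≤y-x (ex≤z w≤B))
      where
      ex≤z : ∀ {x} → x ≤ B → e * x ≤ z
      ex≤z x≤B = ≤-trans (*-monoʳ-≤-nonneg 0≤e x≤B) (subst (e * B ≤_) δB≡z (*-monoˡ-≤-nonneg 0≤B e≤δ))
      z-e[-w]≡z+ew : z - (e * (- w)) ≡ z + e * w
      z-e[-w]≡z+ew = cong (z +_) (trans (cong -_ (sym (-‿distribʳ-* e w))) (-‿involutive (e * w)))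

  feasibleStep : ∀ {n} {z w : Vec n} → (∀ j → 0# ≤ z j) → (∀ j → (¬ z j ≡ 0#) ⊎ w j ≡ 0#) →
    Σ Carrier λ ε → 0# < ε × (∀ j → 0# ≤ z j + ε * w j) × (∀ j → 0# ≤ z j + (- ε) * w j)
  feasibleStep {z = z} {w} 0≤z z≢0⊎w≡0 = ε , ε>0 , (λ j → proj₁ (feasible j)) , (λ j → proj₂ (feasible j))
    where
    step = λ j → coordinateStep (0≤z j) (z≢0⊎w≡0 j)
    lowerBound = positive-lowerBound (λ j → proj₁ (step j)) (λ j → proj₁ (proj₂ (step j)))
    ε = proj₁ lowerBound
    ε>0 = proj₁ (proj₂ lowerBound)
    feasible : ∀ j → 0# ≤ z j + ε * w j × 0# ≤ z j + (- ε) * w j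
    feasible j = proj₂ (proj₂ (step j)) ε (proj₁ ε>0) (proj₂ (proj₂ lowerBound) j)

  vertex⇒support-independent : ∀ {m n} {M : Mat m n} {c z w} → IsVertex M c z → (∀ i → M i ⊙ w ≡ 0#) →
    (∀ j → (¬ z j ≡ 0#) ⊎ w j ≡ 0#) → ∀ j → w j ≡ 0#
  vertex⇒support-independent vz@((_ , 0≤z) , _) Mw≡0 z≢0⊎w≡0 with feasibleStep 0≤z z≢0⊎w≡0
  ... | ε , ε>0 , 0≤z+εw , 0≤z-εw = vertex-rigid vz Mw≡0 ε>0 0≤z+εw 0≤z-εw

  support-bound : ∀ {P p q} {M : Mat P q} {c z} → IsVertex M c z →
    (T : Subset q) → (∀ {j} → j ∈ T → ¬ z j ≡ 0#) →
    (ρ : Fin p → Fin P) → (∀ i → (∃ λ k → ρ k ≡ i) ⊎ (∀ {j} → j ∈ T → M i j ≡ 0#)) → ∣ T ∣ ℕ.≤ p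
  support-bound {M = M} vz T T⊆supp ρ cover = ℕₚ.≮⇒≥ λ p<∣T∣ → ¬¬-kernelVector (M ∘ ρ) T p<∣T∣ absurd
    where
    absurd : KernelVector (M ∘ ρ) T → ⊥
    absurd kv = nonzero (vertex⇒support-independent vz Mw≡0 (∈-cases T T⊆supp (supported _)) witness)
      where
      open KernelVector kv
      Mw≡0 : ∀ i → M i ⊙ vec ≡ 0#
      Mw≡0 i with cover i
      ... | inj₁ (k , refl) = annihilated k
      ... | inj₂ Mᵢ≡0       = ⊙-vanishes (M i) vec (∈-cases T Mᵢ≡0 (supported _))

  IsSupport : ∀ {n} → Subset n → Vec n → Set
  IsSupport S z = ∀ j → (j ∈ S → ¬ z j ≡ 0#) × (j ∉ S → z j ≡ 0#)

  module _ {m n} {p : Subset m} {r : Subset n} {z : Vec (m +ℕ n)} (supp : IsSupport (p ++ r) z) where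

    isSupport-++ˡ : IsSupport p (λ i → z (i ↑ˡ n))
    isSupport-++ˡ i = proj₁ (supp _) ∘ ∈-++⁺ˡ , λ i∉p → proj₂ (supp _) (i∉p ∘ ∈-++⁻ˡ)

    isSupport-++ʳ : IsSupport r (λ j → z (m ↑ʳ j))
    isSupport-++ʳ j = proj₁ (supp _) ∘ ∈-++⁺ʳ , λ j∉r → proj₂ (supp _) (j∉r ∘ ∈-++⁻ʳ)

  module _ {m n s} {p : Subset m} {r : Subset n} {z : Vec (m +ℕ ℕ.suc n)}
           (supp : IsSupport (p ++ (s ∷ r)) z) where

    isSupport-++-∷ : IsSupport r (λ j → z (m ↑ʳ suc j))
    isSupport-++-∷ j = proj₁ (isSupport-++ʳ supp (suc j)) ∘ Vec.there
                     , λ j∉r → proj₂ (isSupport-++ʳ supp (suc j)) (j∉r ∘ drop-there)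

    inside⇒≢0 : s ≡ inside → ¬ z (m ↑ʳ zero) ≡ 0#
    inside⇒≢0 refl = proj₁ (isSupport-++ʳ {p = p} supp zero) Vec.here

    outside⇒≡0 : s ≡ outside → z (m ↑ʳ zero) ≡ 0#
    outside⇒≡0 refl = proj₂ (isSupport-++ʳ {p = p} supp zero) λ ()

  -- Rows of 𝒫: k ↑ˡ _ are those of A, m1' ↑ʳ zero is the coupling row, m1' ↑ʳ suc r those of B.
  -- Columns: j ↑ˡ _ carry x, n1' ↑ʳ zero carries s, n1' ↑ʳ suc l carry y.
  module _ {m1' n1' m2' n2'} (A : Mat m1' n1') (a : Vec n1') (B : Mat m2' n2') (b : Vec n2') where

    Pmat-A-sy : ∀ k l → Pmat A a B b (k ↑ˡ (1 +ℕ m2')) (n1' ↑ʳ l) ≡ 0#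
    Pmat-A-sy k l rewrite splitAt-↑ˡ m1' k (1 +ℕ m2') | splitAt-↑ʳ n1' (1 +ℕ n2') l = refl

    Pmat-B-x : ∀ r j → Pmat A a B b (m1' ↑ʳ suc r) (j ↑ˡ (1 +ℕ n2')) ≡ 0#
    Pmat-B-x r j rewrite splitAt-↑ʳ m1' (1 +ℕ m2') (suc r) | splitAt-↑ˡ n1' j (1 +ℕ n2') = refl

    Pmat-B-s : ∀ r → Pmat A a B b (m1' ↑ʳ suc r) (n1' ↑ʳ zero) ≡ 0#
    Pmat-B-s r rewrite splitAt-↑ʳ m1' (1 +ℕ m2') (suc r) | splitAt-↑ʳ n1' (1 +ℕ n2') zero = refl

    module _ {c z} (vz : IsVertex (Pmat A a B b) c z) {Sx : Subset n1'} {s} {Sy : Subset n2'}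
             (S⊆supp : ∀ {j} → j ∈ Sx ++ (s ∷ Sy) → ¬ z j ≡ 0#) where

      x∪s-bound : ∣ Sx ++ (s ∷ ∅) ∣ ℕ.≤ ℕ.suc m1'
      x∪s-bound = support-bound vz (Sx ++ (s ∷ ∅)) (S⊆supp ∘ ++-mono-⊆ ⊆-refl (s⊆s (⊆-min Sy))) ρ cover
        where
        ρ : Fin (ℕ.suc m1') → Fin (m1' +ℕ (1 +ℕ m2'))
        ρ zero    = m1' ↑ʳ zero
        ρ (suc k) = k ↑ˡ (1 +ℕ m2')
        B-row-vanishes : ∀ r {j} → j ∈ Sx ++ (s ∷ ∅) → Pmat A a B b (m1' ↑ʳ suc r) j ≡ 0#
        B-row-vanishes r {j} j∈T with splitView n1' j
        ... | left j′        = Pmat-B-x r j′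
        ... | right zero     = Pmat-B-s r
        ... | right (suc l)  = ⊥-elim (∉⊥ (drop-there (∈-++⁻ʳ j∈T)))
        cover : ∀ i → (∃ λ k → ρ k ≡ i) ⊎ (∀ {j} → j ∈ Sx ++ (s ∷ ∅) → Pmat A a B b i j ≡ 0#)
        cover i with splitView m1' i
        ... | left k        = inj₁ (suc k , refl)
        ... | right zero    = inj₁ (zero , refl)
        ... | right (suc r) = inj₂ (B-row-vanishes r)

      s∪y-bound : ∣ ∅ {n1'} ++ (s ∷ Sy) ∣ ℕ.≤ ℕ.suc m2'
      s∪y-bound = support-bound vz (∅ ++ (s ∷ Sy)) (S⊆supp ∘ ++-mono-⊆ (⊆-min Sx) ⊆-refl) (m1' ↑ʳ_) cover
        where
        A-row-vanishes : ∀ k {j} → j ∈ ∅ ++ (s ∷ Sy) → Pmat A a B b (k ↑ˡ (1 +ℕ m2')) j ≡ 0#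
        A-row-vanishes k {j} j∈T with splitView n1' j
        ... | left j′  = ⊥-elim (∉⊥ (∈-++⁻ˡ j∈T))
        ... | right l  = Pmat-A-sy k l
        cover : ∀ i → (∃ λ r → m1' ↑ʳ r ≡ i) ⊎ (∀ {j} → j ∈ ∅ ++ (s ∷ Sy) → Pmat A a B b i j ≡ 0#)
        cover i with splitView m1' i
        ... | left k  = inj₂ (A-row-vanishes k)
        ... | right r = inj₁ (r , refl)

x≤a∧y≤b∧x+y≡a+b⇒x≡a∧y≡b : ∀ {x y a b} → x ℕ.≤ a → y ℕ.≤ b → x +ℕ y ≡ a +ℕ b → x ≡ a × y ≡ b
x≤a∧y≤b∧x+y≡a+b⇒x≡a∧y≡b {x} {y} {a} {b} x≤a y≤b x+y≡a+b =
  x≡a , ℕₚ.+-cancelˡ-≡ a y b (trans (cong (_+ℕ y) (sym x≡a)) x+y≡a+b)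
  where
  x≡a : x ≡ a
  x≡a = ℕₚ.≤-antisym x≤a (ℕₚ.≮⇒≥ λ x<a → ℕₚ.<-irrefl x+y≡a+b (ℕₚ.+-mono-<-≤ x<a y≤b))

∣s∷p∣≡∣s∷[]∣+∣p∣ : ∀ {n} s (p : Subset n) → ∣ s ∷ p ∣ ≡ ∣ s ∷ [] ∣ +ℕ ∣ p ∣
∣s∷p∣≡∣s∷[]∣+∣p∣ inside  p = refl
∣s∷p∣≡∣s∷[]∣+∣p∣ outside p = refl

basisSplitℕ : ∀ {X Y m₁ m₂} s → let σ = ∣ s ∷ [] ∣ in
  X +ℕ σ ℕ.≤ ℕ.suc m₁ → σ +ℕ Y ℕ.≤ ℕ.suc m₂ → X +ℕ (σ +ℕ Y) ≡ m₁ +ℕ (1 +ℕ m₂) →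
    (X ≡ m₁ +ℕ 1 × s ≡ outside × Y ≡ m₂)
  ⊎ (X ≡ m₁ × s ≡ inside × Y ≡ m₂)
  ⊎ (X ≡ m₁ × s ≡ outside × Y ≡ 1 +ℕ m₂)
basisSplitℕ {X} {Y} {m₁} {m₂} inside X+1≤ (ℕ.s≤s Y≤m₂) X+1+Y≡
  with x≤a∧y≤b∧x+y≡a+b⇒x≡a∧y≡b (ℕₚ.≤-pred (subst (ℕ._≤ ℕ.suc m₁) (ℕₚ.+-comm X 1) X+1≤)) Y≤m₂
         (ℕₚ.suc-injective (trans (sym (ℕₚ.+-suc X Y)) (trans X+1+Y≡ (ℕₚ.+-suc m₁ m₂))))
... | X≡m₁ , Y≡m₂ = inj₂ (inj₁ (X≡m₁ , refl , Y≡m₂))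
basisSplitℕ {X} {Y} {m₁} {m₂} outside X+0≤ Y≤1+m₂ X+Y≡
  with ℕₚ.m≤n⇒m<n∨m≡n (subst (ℕ._≤ ℕ.suc m₁) (ℕₚ.+-identityʳ X) X+0≤)
... | inj₂ X≡1+m₁ = inj₁ (trans X≡1+m₁ (ℕₚ.+-comm 1 m₁) , refl , Y≡m₂)
  where
  Y≡m₂ : Y ≡ m₂
  Y≡m₂ = ℕₚ.+-cancelˡ-≡ (ℕ.suc m₁) Y m₂ (trans (cong (_+ℕ Y) (sym X≡1+m₁)) (trans X+Y≡ (ℕₚ.+-suc m₁ m₂)))
... | inj₁ X<1+m₁ with x≤a∧y≤b∧x+y≡a+b⇒x≡a∧y≡b (ℕₚ.≤-pred X<1+m₁) Y≤1+m₂ X+Y≡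
...   | X≡m₁ , Y≡1+m₂ = inj₂ (inj₂ (X≡m₁ , refl , Y≡1+m₂))

basisSplit : ∀ {n₁ n₂ m₁ m₂} (Sx : Subset n₁) s (Sy : Subset n₂) →
  ∣ Sx ++ (s ∷ ∅) ∣ ℕ.≤ ℕ.suc m₁ → ∣ ∅ {n₁} ++ (s ∷ Sy) ∣ ℕ.≤ ℕ.suc m₂ →
  ∣ Sx ++ (s ∷ Sy) ∣ ≡ m₁ +ℕ (1 +ℕ m₂) →
    (∣ Sx ∣ ≡ m₁ +ℕ 1 × s ≡ outside × ∣ Sy ∣ ≡ m₂)
  ⊎ (∣ Sx ∣ ≡ m₁ × s ≡ inside × ∣ Sy ∣ ≡ m₂)
  ⊎ (∣ Sx ∣ ≡ m₁ × s ≡ outside × ∣ Sy ∣ ≡ 1 +ℕ m₂)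
basisSplit {n₁} {n₂} Sx s Sy ∣Sx∪s∣≤ ∣s∪Sy∣≤ ∣S∣≡ =
  basisSplitℕ s (subst (ℕ._≤ _) ∣Sx∪s∣≡ ∣Sx∪s∣≤) (subst (ℕ._≤ _) ∣s∪Sy∣≡ ∣s∪Sy∣≤) (trans (sym ∣S∣≡X+σ+Y) ∣S∣≡)
  where
  σ = ∣ s ∷ [] ∣
  ∣Sx∪s∣≡ : ∣ Sx ++ (s ∷ ∅ {n₂}) ∣ ≡ ∣ Sx ∣ +ℕ σ
  ∣Sx∪s∣≡ = trans (∣p++q∣≡∣p∣+∣q∣ Sx (s ∷ ∅ {n₂})) (cong (∣ Sx ∣ +ℕ_)
              (trans (∣s∷p∣≡∣s∷[]∣+∣p∣ s (∅ {n₂})) (trans (cong (σ +ℕ_) (∣⊥∣≡0 n₂)) (ℕₚ.+-identityʳ σ))))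
  ∣s∪Sy∣≡ : ∣ ∅ {n₁} ++ (s ∷ Sy) ∣ ≡ σ +ℕ ∣ Sy ∣
  ∣s∪Sy∣≡ = trans (∣p++q∣≡∣p∣+∣q∣ (∅ {n₁}) (s ∷ Sy))
              (trans (cong (_+ℕ ∣ s ∷ Sy ∣) (∣⊥∣≡0 n₁)) (∣s∷p∣≡∣s∷[]∣+∣p∣ s Sy))
  ∣S∣≡X+σ+Y : ∣ Sx ++ (s ∷ Sy) ∣ ≡ ∣ Sx ∣ +ℕ (σ +ℕ ∣ Sy ∣)
  ∣S∣≡X+σ+Y = trans (∣p++q∣≡∣p∣+∣q∣ Sx (s ∷ Sy)) (cong (∣ Sx ∣ +ℕ_) (∣s∷p∣≡∣s∷[]∣+∣p∣ s Sy))

proposition1 : (F : OrderedField) → let open LP F in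
  {m1' n1' m2' n2' : ℕ} →
  (A : Mat m1' n1') (a : Vec n1') (B : Mat m2' n2') (b : Vec n2') →
  (cA : Vec m1') (cB : Vec m2') (ca cb : Carrier) →
  FullRowRank (Abar A a) → FullRowRank (Bbar B b) →
  Simple (Abar A a) (cQ cA ca) → Simple (Bbar B b) (cR cb cB) →
  Simple (Pmat A a B b) (Prhs cA ca cb cB) →
  (z : Vec (n1' +ℕ (1 +ℕ n2'))) → IsVertex (Pmat A a B b) (Prhs cA ca cb cB) z →
  let x = λ (j : Fin n1') → z (j ↑ˡ (1 +ℕ n2'))
      s = z (n1' ↑ʳ (zero ↑ˡ n2'))
      y = λ (j : Fin n2') → z (n1' ↑ʳ (1 ↑ʳ j))
  in (NonzeroCount x (m1' +ℕ 1) × s ≡ 0# × NonzeroCount y m2')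
   ⊎ (NonzeroCount x m1' × ¬ (s ≡ 0#) × NonzeroCount y m2')
   ⊎ (NonzeroCount x m1' × s ≡ 0# × NonzeroCount y (1 +ℕ m2'))
proposition1 F {n1' = n1'} A a B b _ _ _ _ _ _ _ _ simpleP z vz with simpleP z vz
... | S , supp , ∣S∣≡ with Vec.splitAt n1' S
... | Sx , s ∷ Sy , refl with basisSplit Sx s Sy (x∪s-bound F A a B b vz (proj₁ (supp _)))
                                                 (s∪y-bound F A a B b vz (proj₁ (supp _))) ∣S∣≡
... | inj₁ (∣Sx∣≡ , s≡outside , ∣Sy∣≡) =
  inj₁ ((Sx , isSupport-++ˡ F supp , ∣Sx∣≡) , outside⇒≡0 F supp s≡outside ,
        (Sy , isSupport-++-∷ F supp , ∣Sy∣≡))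
... | inj₂ (inj₁ (∣Sx∣≡ , s≡inside , ∣Sy∣≡)) =
  inj₂ (inj₁ ((Sx , isSupport-++ˡ F supp , ∣Sx∣≡) , inside⇒≢0 F supp s≡inside ,
              (Sy , isSupport-++-∷ F supp , ∣Sy∣≡)))
... | inj₂ (inj₂ (∣Sx∣≡ , s≡outside , ∣Sy∣≡)) =
  inj₂ (inj₂ ((Sx , isSupport-++ˡ F supp , ∣Sx∣≡) , outside⇒≡0 F supp s≡outside ,
              (Sy , isSupport-++-∷ F supp , ∣Sy∣≡)))
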